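{- Let $F\in\mathcal{T}_\lambda$ with coefficients $\lambda_K,\lambda_M$. Then for all integers $n,k$ with $1\le k\le n-1$, setting $m=n-k$, one has $$\binom{n}{k}_F=\lambda_K(k,m)\binom{n-1}{k-1}_F+\lambda_M(k,m)\binom{n-1}{k}_F,$$ with $\binom{n}{n}_F=\binom{n}{0}_F=1$.
   Context: Here $\mathbb{N}=\{1,2,\dots\}$. The family $\mathcal{T}_\lambda$ consists of all sequences $F=(n_F)_{n\ge1}$ of positive integers for which there are coefficients $\lambda_K(k,m),\lambda_M(k,m)\in\mathbb{N}\cup\{0\}$ with $(k+m)_F=\lambda_K(k,m)\,k_F+\lambda_M(k,m)\,m_F$ for all $k,m\in\mathbb{N}$. Notation: $n_F!=n_F(n-1)_F\cdots1_F$ and $0_F!=1$. The $F$-nomial coefficient is $\binom{n}{k}_F=\frac{n_F!}{k_F!\,(n-k)_F!}$. -}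

module Defs where

open import Data.Nat as ℕ using (ℕ; zero; suc; _∸_; NonZero)
open import Data.Nat.Properties using (m*n≢0)
open import Data.Integer using (+_)
open import Data.Rational using (ℚ; _/_)

-- A sequence of positive integers: F : ℕ → ℕ with F n ≠ 0 for n ≥ 1
-- (the value F 0 is irrelevant; n_F = F n for n ≥ 1).
Positive : (ℕ → ℕ) → Set
Positive F = ∀ n → NonZero (F (suc n))

InTλ : (F : ℕ → ℕ) (λK λM : ℕ → ℕ → ℕ) → Set
InTλ F λK λM = ∀ k m → F (suc k ℕ.+ suc m) ≡ λK (suc k) (suc m) ℕ.* F (suc k) ℕ.+ λM (suc k) (suc m) ℕ.* F (suc m)
  where open import Relation.Binary.PropositionalEquality using (_≡_)

Ffact : (ℕ → ℕ) → ℕ → ℕ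
Ffact F zero = 1
Ffact F (suc n) = F (suc n) ℕ.* Ffact F n

Ffact-nonZero : ∀ F → Positive F → ∀ n → NonZero (Ffact F n)
Ffact-nonZero F pos zero = _
Ffact-nonZero F pos (suc n) =
  m*n≢0 (F (suc n)) (Ffact F n) {{pos n}} {{Ffact-nonZero F pos n}}

Fnomial : (F : ℕ → ℕ) → Positive F → ℕ → ℕ → ℚ
Fnomial F pos n k =
  _/_ (+ Ffact F n) (Ffact F k ℕ.* Ffact F (n ∸ k))
    {{m*n≢0 (Ffact F k) (Ffact F (n ∸ k)) {{Ffact-nonZero F pos k}} {{Ffact-nonZero F pos (n ∸ k)}}}}

-- Clearing the denominators k_F! m_F!, the F-Pascal rule becomes
-- n_F! = (λK(k,m) k_F + λM(k,m) m_F) (n-1)_F!, which is the defining relation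
-- n_F = λK(k,m) k_F + λM(k,m) m_F of T_λ multiplied by (n-1)_F!.
module Submission where

open import Defs
open import Data.Nat as ℕ using (ℕ; suc; _∸_; _≤_; NonZero)
open import Data.Integer using (+_)
open import Data.Rational using (ℚ; _+_; _*_; _/_; 1ℚ; toℚᵘ)
open import Data.Product using (_×_; _,_)
open import Relation.Binary.PropositionalEquality
  using (_≡_; refl; sym; trans; cong; cong₂; subst; module ≡-Reasoning)
import Data.Nat.Properties as ℕ
open import Data.Nat.Tactic.RingSolver using (solve-∀)
import Data.Integer as ℤ
import Data.Integer.Properties as ℤ
open import Data.Rational.Properties
  using (toℚᵘ-injective; toℚᵘ-fromℚᵘ; toℚᵘ-homo-+; toℚᵘ-homo-*; /-cong)
open import Data.Rational.Unnormalised as ℚᵘ using (mkℚᵘ; *≡*; _≃_)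
open import Data.Rational.Unnormalised.Properties
  using (≃-sym; ≃-trans; ≃-reflexive; +-cong; *-cong)

toℚᵘ-/ : ∀ i d .{{_ : NonZero d}} → toℚᵘ (i / d) ≃ i ℚᵘ./ d
toℚᵘ-/ i (suc d) = toℚᵘ-fromℚᵘ (mkℚᵘ i d)

/-cross : ∀ a b c d .{{_ : NonZero b}} .{{_ : NonZero d}} →
          a ℕ.* d ≡ c ℕ.* b → (+ a) / b ≡ (+ c) / d
/-cross a b@(suc _) c d@(suc _) ad≡cb = toℚᵘ-injective (≃-trans (toℚᵘ-/ (+ a) b)
  (≃-trans (*≡* (trans (sym (ℤ.pos-* a d)) (trans (cong +_ ad≡cb) (ℤ.pos-* c b))))
           (≃-sym (toℚᵘ-/ (+ c) d))))

/-*-/ : ∀ a b c d .{{_ : NonZero b}} .{{_ : NonZero d}} →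
        ((+ a) / b) * ((+ c) / d) ≡ ((+ (a ℕ.* c)) / (b ℕ.* d)) {{ℕ.m*n≢0 b d}}
/-*-/ a b@(suc _) c d@(suc _) = toℚᵘ-injective (≃-trans (toℚᵘ-homo-* ((+ a) / b) ((+ c) / d))
  (≃-trans (*-cong (toℚᵘ-/ (+ a) b) (toℚᵘ-/ (+ c) d))
  (≃-trans (≃-reflexive (cong (ℚᵘ._/ (b ℕ.* d)) (sym (ℤ.pos-* a c))))
           (≃-sym (toℚᵘ-/ (+ (a ℕ.* c)) (b ℕ.* d))))))

/-+-/ : ∀ a b c d .{{_ : NonZero b}} .{{_ : NonZero d}} →
        ((+ a) / b) + ((+ c) / d) ≡ ((+ (a ℕ.* d ℕ.+ c ℕ.* b)) / (b ℕ.* d)) {{ℕ.m*n≢0 b d}}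
/-+-/ a b@(suc _) c d@(suc _) = toℚᵘ-injective (≃-trans (toℚᵘ-homo-+ ((+ a) / b) ((+ c) / d))
  (≃-trans (+-cong (toℚᵘ-/ (+ a) b) (toℚᵘ-/ (+ c) d))
  (≃-trans (≃-reflexive (cong (ℚᵘ._/ (b ℕ.* d)) numerator))
           (≃-sym (toℚᵘ-/ (+ (a ℕ.* d ℕ.+ c ℕ.* b)) (b ℕ.* d))))))
  where
  numerator : + a ℤ.* + d ℤ.+ + c ℤ.* + b ≡ + (a ℕ.* d ℕ.+ c ℕ.* b)
  numerator = sym (trans (ℤ.pos-+ (a ℕ.* d) (c ℕ.* b)) (cong₂ ℤ._+_ (ℤ.pos-* a d) (ℤ.pos-* c b)))

scale-/ : ∀ a c d .{{_ : NonZero d}} → ((+ a) / 1) * ((+ c) / d) ≡ (+ (a ℕ.* c)) / d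
scale-/ a c d@(suc _) = trans (/-*-/ a 1 c d) (/-cong {+ (a ℕ.* c)} refl (ℕ.*-identityˡ d))

-- The F-Pascal rule in the variables k_F = a, m_F = b, (k-1)_F! = P, (m-1)_F! = Q
-- and (n-1)_F! = X, so that k_F! = a P and m_F! = b Q.
module _ (a b P Q : ℕ) .{{_ : NonZero a}} .{{_ : NonZero b}} .{{_ : NonZero P}} .{{_ : NonZero Q}} where

  private
    D₁ = P ℕ.* (b ℕ.* Q)
    D₂ = (a ℕ.* P) ℕ.* Q

    instance
      aP-nonZero : NonZero (a ℕ.* P)
      aP-nonZero = ℕ.m*n≢0 a P
      bQ-nonZero : NonZero (b ℕ.* Q)
      bQ-nonZero = ℕ.m*n≢0 b Q
      D₁-nonZero : NonZero D₁
      D₁-nonZero = ℕ.m*n≢0 P (b ℕ.* Q)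
      D₂-nonZero : NonZero D₂
      D₂-nonZero = ℕ.m*n≢0 (a ℕ.* P) Q
      aPbQ-nonZero : NonZero ((a ℕ.* P) ℕ.* (b ℕ.* Q))
      aPbQ-nonZero = ℕ.m*n≢0 (a ℕ.* P) (b ℕ.* Q)
      D₁D₂-nonZero : NonZero (D₁ ℕ.* D₂)
      D₁D₂-nonZero = ℕ.m*n≢0 D₁ D₂

  pascal-fraction : ∀ lK lM X →
    (+ ((lK ℕ.* a ℕ.+ lM ℕ.* b) ℕ.* X)) / ((a ℕ.* P) ℕ.* (b ℕ.* Q))
    ≡ (+ lK) / 1 * ((+ X) / D₁) + (+ lM) / 1 * ((+ X) / D₂)
  pascal-fraction lK lM X = begin
    (+ ((lK ℕ.* a ℕ.+ lM ℕ.* b) ℕ.* X)) / ((a ℕ.* P) ℕ.* (b ℕ.* Q))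
      ≡⟨ /-cross ((lK ℕ.* a ℕ.+ lM ℕ.* b) ℕ.* X) ((a ℕ.* P) ℕ.* (b ℕ.* Q))
                 (lK ℕ.* X ℕ.* D₂ ℕ.+ lM ℕ.* X ℕ.* D₁) (D₁ ℕ.* D₂) (cleared lK lM a b X P Q) ⟩
    (+ (lK ℕ.* X ℕ.* D₂ ℕ.+ lM ℕ.* X ℕ.* D₁)) / (D₁ ℕ.* D₂)
      ≡⟨ /-+-/ (lK ℕ.* X) D₁ (lM ℕ.* X) D₂ ⟨
    (+ (lK ℕ.* X)) / D₁ + (+ (lM ℕ.* X)) / D₂
      ≡⟨ cong₂ _+_ (scale-/ lK X D₁) (scale-/ lM X D₂) ⟨
    (+ lK) / 1 * ((+ X) / D₁) + (+ lM) / 1 * ((+ X) / D₂) ∎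
    where
    open ≡-Reasoning

    cleared : ∀ lK lM a b X P Q →
      (lK ℕ.* a ℕ.+ lM ℕ.* b) ℕ.* X ℕ.* ((P ℕ.* (b ℕ.* Q)) ℕ.* ((a ℕ.* P) ℕ.* Q))
      ≡ (lK ℕ.* X ℕ.* ((a ℕ.* P) ℕ.* Q) ℕ.+ lM ℕ.* X ℕ.* (P ℕ.* (b ℕ.* Q)))
        ℕ.* ((a ℕ.* P) ℕ.* (b ℕ.* Q))
    cleared = solve-∀

module _ (F : ℕ → ℕ) (pos : Positive F) where

  Ffact*Ffact-nonZero : ∀ a b → NonZero (Ffact F a ℕ.* Ffact F b)
  Ffact*Ffact-nonZero a b = ℕ.m*n≢0 _ _ {{Ffact-nonZero F pos a}} {{Ffact-nonZero F pos b}}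

  Fnomial-≡-/ : ∀ n k {l x} → Ffact F n ≡ x → n ∸ k ≡ l →
    Fnomial F pos n k ≡ ((+ x) / (Ffact F k ℕ.* Ffact F l)) {{Ffact*Ffact-nonZero k l}}
  Fnomial-≡-/ n k {l} n!≡x n∸k≡l =
    /-cong {{Ffact*Ffact-nonZero k (n ∸ k)}} {{Ffact*Ffact-nonZero k l}}
      (cong +_ n!≡x) (cong (λ l → Ffact F k ℕ.* Ffact F l) n∸k≡l)

  Fnomial-diagonal : ∀ n → Fnomial F pos n n ≡ 1ℚ
  Fnomial-diagonal n = trans (Fnomial-≡-/ n n refl (ℕ.n∸n≡0 n))
    (/-cross (Ffact F n) _ 1 1 {{Ffact*Ffact-nonZero n 0}} (sym (ℕ.*-identityˡ _)))

  Fnomial-zero : ∀ n → Fnomial F pos n 0 ≡ 1ℚ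
  Fnomial-zero n = /-cross (Ffact F n) _ 1 1 {{Ffact*Ffact-nonZero 0 n}}
    (trans (ℕ.*-identityʳ _) (sym (trans (ℕ.*-identityˡ _) (ℕ.*-identityˡ _))))

  FPascal : (λK λM : ℕ → ℕ → ℕ) → ℕ → ℕ → Set
  FPascal λK λM n k =
    Fnomial F pos n k ≡ (+ λK k (n ∸ k)) / 1 * Fnomial F pos (n ∸ 1) (k ∸ 1)
                        + (+ λM k (n ∸ k)) / 1 * Fnomial F pos (n ∸ 1) k

  module _ (λK λM : ℕ → ℕ → ℕ) (Tλ : InTλ F λK λM) where

    Fnomial-pascal-suc : ∀ j q → FPascal λK λM (suc j ℕ.+ suc q) (suc j)
    Fnomial-pascal-suc j q =
      subst (λ l → Fnomial F pos n k ≡ (+ λK k l) / 1 * Fnomial F pos p j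
                                       + (+ λM k l) / 1 * Fnomial F pos p k)
            (sym (ℕ.m+n∸m≡n j m)) (begin
        Fnomial F pos n k
          ≡⟨ Fnomial-≡-/ n k (cong (ℕ._* Ffact F p) (Tλ j q)) (ℕ.m+n∸m≡n j m) ⟩
        _ ≡⟨ pascal-fraction (F k) (F m) (Ffact F j) (Ffact F q)
               {{pos j}} {{pos q}} {{Ffact-nonZero F pos j}} {{Ffact-nonZero F pos q}}
               (λK k m) (λM k m) (Ffact F p) ⟩
        _ ≡⟨ cong₂ (λ x y → (+ λK k m) / 1 * x + (+ λM k m) / 1 * y)
               (Fnomial-≡-/ p j refl (ℕ.m+n∸m≡n j m)) (Fnomial-≡-/ p k refl p∸k≡q) ⟨
        (+ λK k m) / 1 * Fnomial F pos p j + (+ λM k m) / 1 * Fnomial F pos p k ∎)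
      where
      open ≡-Reasoning
      k = suc j
      m = suc q
      p = j ℕ.+ m
      n = suc p

      p∸k≡q : p ∸ k ≡ q
      p∸k≡q = trans (cong (_∸ k) (ℕ.+-suc j q)) (ℕ.m+n∸m≡n j q)

    Fnomial-pascal-rule : ∀ n k → 1 ≤ k → k ≤ n ∸ 1 → FPascal λK λM n k
    Fnomial-pascal-rule (suc p) (suc j) _ j<p =
      subst (λ p → FPascal λK λM (suc p) (suc j)) split (Fnomial-pascal-suc j (p ∸ suc j))
      where
      split : j ℕ.+ suc (p ∸ suc j) ≡ p
      split = trans (ℕ.+-suc j (p ∸ suc j)) (ℕ.m+[n∸m]≡n j<p)

mainTheorem3 : (F : ℕ → ℕ) (pos : Positive F) (λK λM : ℕ → ℕ → ℕ) → InTλ F λK λM →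
    ((n k : ℕ) → 1 ≤ k → k ≤ n ∸ 1 →
      Fnomial F pos n k ≡ (+ λK k (n ∸ k)) / 1 * Fnomial F pos (n ∸ 1) (k ∸ 1)
                           + (+ λM k (n ∸ k)) / 1 * Fnomial F pos (n ∸ 1) k)
    × ((n : ℕ) → Fnomial F pos n n ≡ 1ℚ × Fnomial F pos n 0 ≡ 1ℚ)
mainTheorem3 F pos λK λM Tλ =
  Fnomial-pascal-rule F pos λK λM Tλ , λ n → Fnomial-diagonal F pos n , Fnomial-zero F pos n
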